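{- Let $\mathcal{K}=(S,s_\mathit{init},\mathbb{D},\kappa,\ell)$ be a Kripke structure, $\varphi=\forall\pi_1.\exists\pi_2.\psi$ a HyperLTL formula, and $\mathcal{A}_\psi$ a deterministic parity automaton recognizing $\psi$. Then the coalition $\{2\}$ wins the multiplayer game $\mathcal{G}_{\mathcal{K},\varphi}$ if and only if the verifier wins the two-player parity game $\mathcal{G}^{\forall\exists}_{\mathcal{K},\varphi}$ (both games built from the same $\mathcal{A}_\psi$ as described in the context).
   Context: Kripke structure $\mathcal{K}=(S,s_\mathit{init},\mathbb{D},\kappa,\ell)$ over $\mathit{AP}$: finite $S$, initial state $s_\mathit{init}\notin S$, directions $\mathbb{D}$, $\kappa:(S\uplus\{s_\mathit{init}\})\times\mathbb{D}\to S$, $\ell:(S\uplus\{s_\mathit{init}\})\to2^{\mathit{AP}}$. In $\varphi=\forall\pi_1.\exists\pi_2.\psi$, $\psi$ is an LTL formula over $\mathit{AP}_\psi=\{a_{\pi_i}\mid a\in\mathit{AP},i\in\{1,2\}\}$. A DPA $\mathcal{A}_\psi=(2^{\mathit{AP}_\psi},Q_\psi,q_{0,\psi},\delta_\psi,c_\psi)$ (deterministic transitions $\delta_\psi$, coloring $c_\psi:Q_\psi\to\mathbb{N}$, accepting iff minimal color seen infinitely often is even) recognizes $\psi$. Write $L(s_1,s_2)=\bigcup_{i=1}^2\{a_{\pi_i}\mid a\in\ell(s_i)\}$. Two-player parity game $\mathcal{G}^{\forall\exists}_{\mathcal{K},\varphi}$: vertices $\langle s_1,s_2,q,x\rangle$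 with $s_1,s_2\in S\uplus\{s_\mathit{init}\}$, $q\in Q_\psi$, $x\in\{\mathfrak{V},\mathfrak{R}\}$ (owned by verifier $\mathfrak{V}$ resp. refuter $\mathfrak{R}$); initial vertex $\langle s_\mathit{init},s_\mathit{init},q_{0,\psi},\mathfrak{R}\rangle$; directions $\mathbb{D}$; $E(\langle s_1,s_2,q,\mathfrak{V}\rangle,d)=\langle s_1,\kappa(s_2,d),q,\mathfrak{R}\rangle$, $E(\langle s_1,s_2,q,\mathfrak{R}\rangle,d)=\langle\kappa(s_1,d),s_2,\delta_\psi(q,L(s_1,s_2)),\mathfrak{V}\rangle$; color $c_\psi(q)$. A verifier strategy is any $\sigma:V^*\cdot V_\mathfrak{V}\to\mathbb{D}$ (full information); a play $\rho$ is compatible with $\sigma$ if $\rho(0)$ is initial and $\rho(i+1)=E(\rho(i),\sigma(\rho[0,i]))$ whenever $\rho(i)\in V_\mathfrak{V}$ (refuter moves arbitrary). The verifier wins if some $\sigma$ makes every compatible play even (minimal color seen infinitely often is even). Multiplayer game $\mathcal{G}_{\mathcal{K},\varphi}$ (here $n=2$): players $\{1,2\}$; vertices $\langle s_1,s_2,q,p\rangle$ owned by $p\in\{1,2\}$; initial $\langle s_\mathit{init},s_\mathit{init},q_{0,\psi},1\rangle$; $E(\langle s_1,s_2,q,2\rangle,d)=\langle s_1,\kappa(s_2,d),q,1\rangle$, $E(\langle s_1,s_2,q,1\rangle,d)=\langle\kappa(s_1,d),s_2,\delta_\psi(q,L(s_1,s_2)),2\rangle$; color $c_\psi(q)$; indistinguishability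 $\langle s_1,s_2,q,p'\rangle\sim_p\langle s'_1,s'_2,q',p''\rangle$ iff $p'=p''$ and $s_j=s'_j$ for all $j\le p$. Plays $\rho_1\sim_p\rho_2$ if equal length and pointwise related; a strategy for $p$ is $\sigma_p:V^*\cdot V_p\to\mathbb{D}$ constant on $\sim_p$-indistinguishable plays; strategy families determine a unique play ($\rho(i+1)=E(\rho(i),\sigma_p(\rho[0,i]))$ for the owner $p$ of $\rho(i)$). Coalition $A$ wins if there are strategies for $A$ such that for all strategies of the other players the resulting play is even. -}

module Defs where

open import Data.Nat using (ℕ; zero; suc; _≤_; _<_)
open import Data.Nat.Divisibility using (_∣_)
open import Data.Fin using (Fin; zero; suc)
open import Data.Bool using (Bool; true)
open import Data.List using (List; map; upTo)
open import Data.List.Relation.Binary.Pointwise using (Pointwise)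
open import Data.Product using (Σ; ∃; _×_; _,_)
open import Relation.Binary.PropositionalEquality using (_≡_; refl)
open import Data.Unit using (⊤)
open import Data.Empty using (⊥)

-- Kripke structures over the atomic propositions AP = Fin nAP.
-- States S = Fin nS, directions 𝔻 = Fin nD, S ⊎ {s_init} = SI nS.

data SI (n : ℕ) : Set where
  sinit : SI n
  st    : Fin n → SI n

record Kripke (nAP : ℕ) : Set where
  field
    nS nD : ℕ
    κ : SI nS → Fin nD → Fin nS
    ℓ : SI nS → (Fin nAP → Bool)

-- AP_ψ = { a_{π_i} | a ∈ AP, i ∈ {1,2} } ; (a , zero) = a_{π₁}, (a , suc zero) = a_{π₂}

APψ : ℕ → Set
APψ nAP = Fin nAP × Fin 2

Letter : ℕ → Set
Letter nAP = APψ nAP → Bool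

Word : ℕ → Set
Word nAP = ℕ → Letter nAP

data LTL (X : Set) : Set where
  ⊤ₗ   : LTL X
  atom : X → LTL X
  ¬ₗ   : LTL X → LTL X
  _∧ₗ_ : LTL X → LTL X → LTL X
  Xₗ   : LTL X → LTL X
  _Uₗ_ : LTL X → LTL X → LTL X

_,_⊨_ : {X : Set} → (ℕ → X → Bool) → ℕ → LTL X → Set
w , i ⊨ ⊤ₗ       = ⊤
w , i ⊨ atom a   = w i a ≡ true
w , i ⊨ ¬ₗ φ     = w , i ⊨ φ → ⊥
w , i ⊨ (φ ∧ₗ θ) = (w , i ⊨ φ) × (w , i ⊨ θ)
w , i ⊨ Xₗ φ     = w , suc i ⊨ φ
w , i ⊨ (φ Uₗ θ) = ∃ λ k → i ≤ k × (w , k ⊨ θ) × (∀ j → i ≤ j → j < k → w , j ⊨ φ)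

MinInfEven : (ℕ → ℕ) → Set
MinInfEven f =
  Σ ℕ λ c → (2 ∣ c)
          × (∀ i → ∃ λ j → i ≤ j × f j ≡ c)
          × (∃ λ N → ∀ j → N ≤ j → c ≤ f j)

record DPA (nAP : ℕ) : Set where
  field
    nQ : ℕ
    q₀ : Fin nQ
    δ  : Fin nQ → Letter nAP → Fin nQ
    c  : Fin nQ → ℕ

module _ {nAP : ℕ} (A : DPA nAP) where
  open DPA A

  runDPA : Word nAP → ℕ → Fin nQ
  runDPA w zero    = q₀
  runDPA w (suc i) = δ (runDPA w i) (w i)

  Accepts : Word nAP → Set
  Accepts w = MinInfEven (λ i → c (runDPA w i))

Recognizes : {nAP : ℕ} → DPA nAP → LTL (APψ nAP) → Set
Recognizes A ψ = ∀ w → (Accepts A w → w , 0 ⊨ ψ) × (w , 0 ⊨ ψ → Accepts A w)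

module Games {nAP : ℕ} (K : Kripke nAP) (A : DPA nAP) where
  open Kripke K
  open DPA A

  L : SI nS → SI nS → Letter nAP
  L s₁ s₂ (a , zero)     = ℓ s₁ a
  L s₁ s₂ (a , suc zero) = ℓ s₂ a

  record Vtx (O : Set) : Set where
    constructor ⟨_,_,_,_⟩
    field
      s₁ s₂ : SI nS
      q     : Fin nQ
      own   : O
  open Vtx public

  prefix : {V : Set} → (ℕ → V) → ℕ → List V
  prefix ρ i = map ρ (upTo i)

  EvenPlay : {O : Set} → (ℕ → Vtx O) → Set
  EvenPlay ρ = MinInfEven (λ i → c (q (ρ i)))

  data Own : Set where
    𝔙 ℜ : Own

  V₂ : Set
  V₂ = Vtx Own

  init₂ : V₂
  init₂ = ⟨ sinit , sinit , q₀ , ℜ ⟩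

  E₂ : V₂ → Fin nD → V₂
  E₂ ⟨ s₁ , s₂ , q , 𝔙 ⟩ d = ⟨ s₁ , st (κ s₂ d) , q , ℜ ⟩
  E₂ ⟨ s₁ , s₂ , q , ℜ ⟩ d = ⟨ st (κ s₁ d) , s₂ , δ q (L s₁ s₂) , 𝔙 ⟩

  -- verifier strategy σ : V* · V_𝔙 → 𝔻 (history given as prefix list + last vertex)
  VStrategy : Set
  VStrategy = (h : List V₂) (v : V₂) → own v ≡ 𝔙 → Fin nD

  Compatible : VStrategy → (ℕ → V₂) → Set
  Compatible σ ρ =
      ρ 0 ≡ init₂
    × (∀ i → (e : own (ρ i) ≡ 𝔙) → ρ (suc i) ≡ E₂ (ρ i) (σ (prefix ρ i) (ρ i) e))
    × (∀ i → own (ρ i) ≡ ℜ → ∃ λ d → ρ (suc i) ≡ E₂ (ρ i) d)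

  VerifierWins : Set
  VerifierWins = Σ VStrategy λ σ → ∀ ρ → Compatible σ ρ → EvenPlay ρ

  data Player : Set where
    p₁ p₂ : Player

  Vm : Set
  Vm = Vtx Player

  initm : Vm
  initm = ⟨ sinit , sinit , q₀ , p₁ ⟩

  Em : Vm → Fin nD → Vm
  Em ⟨ s₁ , s₂ , q , p₂ ⟩ d = ⟨ s₁ , st (κ s₂ d) , q , p₁ ⟩
  Em ⟨ s₁ , s₂ , q , p₁ ⟩ d = ⟨ st (κ s₁ d) , s₂ , δ q (L s₁ s₂) , p₂ ⟩

  Indist : Player → Vm → Vm → Set
  Indist p₁ v v' = own v ≡ own v' × s₁ v ≡ s₁ v'
  Indist p₂ v v' = own v ≡ own v' × s₁ v ≡ s₁ v' × s₂ v ≡ s₂ v'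

  Strategy : Player → Set
  Strategy p =
    Σ ((h : List Vm) (v : Vm) → own v ≡ p → Fin nD) λ σ →
      ∀ h v e h' v' e' → Pointwise (Indist p) h h' → Indist p v v' → σ h v e ≡ σ h' v' e'

  dispatch : Strategy p₁ → Strategy p₂ → List Vm → (v : Vm) → (p : Player) → own v ≡ p → Fin nD
  dispatch (σ₁ , _) σ₂ h v p₁ e = σ₁ h v e
  dispatch σ₁ (σ₂ , _) h v p₂ e = σ₂ h v e

  Outcome : Strategy p₁ → Strategy p₂ → (ℕ → Vm) → Set
  Outcome σ₁ σ₂ ρ =
      ρ 0 ≡ initm
    × (∀ i → ρ (suc i) ≡ Em (ρ i) (dispatch σ₁ σ₂ (prefix ρ i) (ρ i) (own (ρ i)) refl))

  Coalition2Wins : Set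
  Coalition2Wins = Σ (Strategy p₂) λ σ₂ → ∀ (σ₁ : Strategy p₁) ρ → Outcome σ₁ σ₂ ρ → EvenPlay ρ

{-# OPTIONS --safe #-}
module Submission where

open import Defs
open import Data.Nat using (ℕ; zero; suc)
open import Data.Fin using (Fin)
open import Data.List using (List; []; _∷_; map; length; upTo; applyUpTo)
open import Data.List.Properties using (map-upTo; map-∘; length-map; length-upTo)
open import Data.List.Relation.Binary.Pointwise using (Pointwise; []; _∷_; Pointwise-length)
open import Data.Product using (∃-syntax; _,_; proj₁; proj₂)
open import Function.Base using (_∘_)
open import Function.Bundles using (_⇔_; mk⇔)
open import Relation.Binary.PropositionalEquality
  using (_≡_; refl; sym; trans; cong; cong₂; module ≡-Reasoning)

-- The two games share one arena up to renaming owners (ℜ as player 1, 𝔙 as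
-- player 2) and differ only in what is observed. Player 2 sees both Kripke
-- components, and the automaton component of a history is determined by them,
-- so player 2 can run a verifier strategy after recomputing the automaton
-- states. Conversely, player 1's blindness to s₂ is harmless: whatever the
-- refuter does along one play is reproduced by a player-1 strategy that only
-- looks at the clock.

module Simulation {nAP : ℕ} (K : Kripke nAP) (A : DPA nAP) where
  open Kripke K
  open DPA A
  open Games K A
  open ≡-Reasoning

  prefix-applyUpTo : ∀ {V : Set} (ρ : ℕ → V) i → prefix ρ i ≡ applyUpTo ρ i
  prefix-applyUpTo = map-upTo

  prefix-∘ : ∀ {V W : Set} (f : V → W) (ρ : ℕ → V) i → prefix (f ∘ ρ) i ≡ map f (prefix ρ i)
  prefix-∘ f ρ i = map-∘ (upTo i)

  length-prefix : ∀ {V : Set} (ρ : ℕ → V) i → length (prefix ρ i) ≡ i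
  length-prefix ρ i = trans (length-map ρ (upTo i)) (length-upTo i)

  player : Own → Player
  player ℜ = p₁
  player 𝔙 = p₂

  role : Player → Own
  role p₁ = ℜ
  role p₂ = 𝔙

  toVm : V₂ → Vm
  toVm v = ⟨ s₁ v , s₂ v , q v , player (own v) ⟩

  toV₂ : Vm → V₂
  toV₂ v = ⟨ s₁ v , s₂ v , q v , role (own v) ⟩

  toVm-E₂ : ∀ v d → toVm (E₂ v d) ≡ Em (toVm v) d
  toVm-E₂ ⟨ _ , _ , _ , 𝔙 ⟩ d = refl
  toVm-E₂ ⟨ _ , _ , _ , ℜ ⟩ d = refl

  toV₂-Em : ∀ v d → toV₂ (Em v d) ≡ E₂ (toV₂ v) d
  toV₂-Em ⟨ _ , _ , _ , p₁ ⟩ d = refl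
  toV₂-Em ⟨ _ , _ , _ , p₂ ⟩ d = refl

  VStrategy-irrelevant : ∀ (σ : VStrategy) h v (e : own v ≡ 𝔙) →
                         σ h v e ≡ σ h ⟨ s₁ v , s₂ v , q v , 𝔙 ⟩ refl
  VStrategy-irrelevant σ h ⟨ _ , _ , _ , 𝔙 ⟩ refl = refl

  compatible-moves : ∀ {σ ρ} → Compatible σ ρ → ∀ i → ∃[ d ] ρ (suc i) ≡ E₂ (ρ i) d
  compatible-moves {σ} {ρ} (_ , 𝔙-move , ℜ-move) i with own (ρ i) in e
  ... | 𝔙 = _ , 𝔙-move i e
  ... | ℜ = ℜ-move i e

  clockStrategy : ∀ {p} → (ℕ → Fin nD) → Strategy p
  clockStrategy move =
    (λ h _ _ → move (length h)) , λ _ _ _ _ _ _ hh _ → cong move (Pointwise-length hh)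

  moveQ : Player → SI nS → SI nS → Fin nQ → Fin nQ
  moveQ p₁ s s' q' = δ q' (L s s')
  moveQ p₂ _ _  q' = q'

  stepQ : Vm → Fin nQ → Fin nQ
  stepQ v = moveQ (own v) (s₁ v) (s₂ v)

  q-Em : ∀ v d → q (Em v d) ≡ stepQ v (q v)
  q-Em ⟨ _ , _ , _ , p₁ ⟩ d = refl
  q-Em ⟨ _ , _ , _ , p₂ ⟩ d = refl

  TracksAutomaton : (ℕ → Vm) → Set
  TracksAutomaton ρ = ∀ k → q (ρ (suc k)) ≡ stepQ (ρ k) (q (ρ k))

  recomputeQ : Fin nQ → List Vm → List Vm
  recomputeQ q' []      = []
  recomputeQ q' (v ∷ h) = ⟨ s₁ v , s₂ v , q' , own v ⟩ ∷ recomputeQ (stepQ v q') h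

  qAfter : Fin nQ → List Vm → Fin nQ
  qAfter q' []      = q'
  qAfter q' (v ∷ h) = qAfter (stepQ v q') h

  recomputeQ-Indist : ∀ q' {h h'} → Pointwise (Indist p₂) h h' → recomputeQ q' h ≡ recomputeQ q' h'
  recomputeQ-Indist q' [] = refl
  recomputeQ-Indist q' {⟨ a , b , _ , o ⟩ ∷ _} {⟨ .a , .b , _ , .o ⟩ ∷ _} ((refl , refl , refl) ∷ hh) =
    cong (_ ∷_) (recomputeQ-Indist _ hh)

  qAfter-Indist : ∀ q' {h h'} → Pointwise (Indist p₂) h h' → qAfter q' h ≡ qAfter q' h'
  qAfter-Indist q' [] = refl
  qAfter-Indist q' {⟨ a , b , _ , o ⟩ ∷ _} {⟨ .a , .b , _ , .o ⟩ ∷ _} ((refl , refl , refl) ∷ hh) =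
    qAfter-Indist _ hh

  recomputeQ-applyUpTo : ∀ ρ → TracksAutomaton ρ → ∀ {q'} → q (ρ 0) ≡ q' →
                         ∀ i → recomputeQ q' (applyUpTo ρ i) ≡ applyUpTo ρ i
  recomputeQ-applyUpTo ρ tracks refl zero    = refl
  recomputeQ-applyUpTo ρ tracks refl (suc i) =
    cong (ρ 0 ∷_) (recomputeQ-applyUpTo (ρ ∘ suc) (tracks ∘ suc) (tracks 0) i)

  qAfter-applyUpTo : ∀ ρ → TracksAutomaton ρ → ∀ {q'} → q (ρ 0) ≡ q' →
                     ∀ i → qAfter q' (applyUpTo ρ i) ≡ q (ρ i)
  qAfter-applyUpTo ρ tracks refl zero    = refl
  qAfter-applyUpTo ρ tracks refl (suc i) = qAfter-applyUpTo (ρ ∘ suc) (tracks ∘ suc) (tracks 0) i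

  module FromVerifier (σ : VStrategy) where
    choose : List Vm → Vm → Fin nD
    choose h v = σ (map toV₂ (recomputeQ q₀ h)) ⟨ s₁ v , s₂ v , qAfter q₀ h , 𝔙 ⟩ refl

    σ₂ : Strategy p₂
    σ₂ = (λ h v _ → choose h v) , choose-Indist
      where
      choose-Indist : ∀ h v e h' v' e' → Pointwise (Indist p₂) h h' → Indist p₂ v v' →
                      choose h v ≡ choose h' v'
      choose-Indist _ ⟨ a , b , _ , _ ⟩ _ _ ⟨ .a , .b , _ , _ ⟩ _ hh (_ , refl , refl) =
        cong₂ (λ h Q → σ (map toV₂ h) ⟨ a , b , Q , 𝔙 ⟩ refl)
              (recomputeQ-Indist q₀ hh) (qAfter-Indist q₀ hh)

    dispatch-σ₂ : ∀ σ₁ h v → own (toV₂ v) ≡ 𝔙 → dispatch σ₁ σ₂ h v (own v) refl ≡ choose h v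
    dispatch-σ₂ σ₁ h ⟨ _ , _ , _ , p₂ ⟩ _ = refl

    project : ∀ σ₁ ρ → Outcome σ₁ σ₂ ρ → Compatible σ (toV₂ ∘ ρ)
    project σ₁ ρ (ρ0 , play) = cong toV₂ ρ0 , 𝔙-move , λ i _ → _ , move i
      where
      move : ∀ i → toV₂ (ρ (suc i)) ≡ E₂ (toV₂ (ρ i)) (dispatch σ₁ σ₂ (prefix ρ i) (ρ i) (own (ρ i)) refl)
      move i = trans (cong toV₂ (play i)) (toV₂-Em (ρ i) _)

      tracks : TracksAutomaton ρ
      tracks k = trans (cong q (play k)) (q-Em (ρ k) _)

      recomputed : ∀ i → recomputeQ q₀ (prefix ρ i) ≡ prefix ρ i
      recomputed i rewrite prefix-applyUpTo ρ i = recomputeQ-applyUpTo ρ tracks (cong q ρ0) i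

      reached : ∀ i → qAfter q₀ (prefix ρ i) ≡ q (ρ i)
      reached i rewrite prefix-applyUpTo ρ i = qAfter-applyUpTo ρ tracks (cong q ρ0) i

      chosen : ∀ i (e : own (toV₂ (ρ i)) ≡ 𝔙) →
               choose (prefix ρ i) (ρ i) ≡ σ (prefix (toV₂ ∘ ρ) i) (toV₂ (ρ i)) e
      chosen i e = begin
        choose (prefix ρ i) (ρ i)
          ≡⟨ cong₂ (λ h Q → σ (map toV₂ h) ⟨ s₁ (ρ i) , s₂ (ρ i) , Q , 𝔙 ⟩ refl) (recomputed i) (reached i) ⟩
        σ (map toV₂ (prefix ρ i)) ⟨ s₁ (ρ i) , s₂ (ρ i) , q (ρ i) , 𝔙 ⟩ refl
          ≡⟨ cong (λ h → σ h ⟨ s₁ (ρ i) , s₂ (ρ i) , q (ρ i) , 𝔙 ⟩ refl) (sym (prefix-∘ toV₂ ρ i)) ⟩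
        σ (prefix (toV₂ ∘ ρ) i) ⟨ s₁ (ρ i) , s₂ (ρ i) , q (ρ i) , 𝔙 ⟩ refl
          ≡⟨ sym (VStrategy-irrelevant σ _ (toV₂ (ρ i)) e) ⟩
        σ (prefix (toV₂ ∘ ρ) i) (toV₂ (ρ i)) e ∎

      𝔙-move : ∀ i (e : own (toV₂ (ρ i)) ≡ 𝔙) →
               toV₂ (ρ (suc i)) ≡ E₂ (toV₂ (ρ i)) (σ (prefix (toV₂ ∘ ρ) i) (toV₂ (ρ i)) e)
      𝔙-move i e = trans (move i) (cong (E₂ (toV₂ (ρ i))) (trans (dispatch-σ₂ σ₁ _ (ρ i) e) (chosen i e)))

  module FromCoalition (σ₂ : Strategy p₂) where
    σ : VStrategy
    σ h v e = proj₁ σ₂ (map toVm h) (toVm v) (cong player e)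

    lift-step : ∀ σ₁ h v w →
                ((e : own v ≡ 𝔙) → w ≡ E₂ v (σ h v e)) →
                ((e : own v ≡ ℜ) → w ≡ E₂ v (proj₁ σ₁ (map toVm h) (toVm v) (cong player e))) →
                toVm w ≡ Em (toVm v) (dispatch σ₁ σ₂ (map toVm h) (toVm v) (own (toVm v)) refl)
    lift-step σ₁ h v@(⟨ _ , _ , _ , 𝔙 ⟩) w 𝔙-move _ = trans (cong toVm (𝔙-move refl)) (toVm-E₂ v _)
    lift-step σ₁ h v@(⟨ _ , _ , _ , ℜ ⟩) w _ ℜ-move = trans (cong toVm (ℜ-move refl)) (toVm-E₂ v _)

    lift : ∀ ρ → Compatible σ ρ → ∃[ σ₁ ] Outcome σ₁ σ₂ (toVm ∘ ρ)
    lift ρ compatible@(ρ0 , 𝔙-move , _) = σ₁ , cong toVm ρ0 , outcome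
      where
      moves : ∀ i → ∃[ d ] ρ (suc i) ≡ E₂ (ρ i) d
      moves = compatible-moves {σ} compatible

      σ₁ : Strategy p₁
      σ₁ = clockStrategy (proj₁ ∘ moves)

      clock : ∀ i → length (map toVm (prefix ρ i)) ≡ i
      clock i = trans (length-map toVm (prefix ρ i)) (length-prefix ρ i)

      outcome : ∀ i → toVm (ρ (suc i)) ≡
                Em (toVm (ρ i)) (dispatch σ₁ σ₂ (prefix (toVm ∘ ρ) i) (toVm (ρ i)) (own (toVm (ρ i))) refl)
      outcome i rewrite prefix-∘ toVm ρ i =
        lift-step σ₁ (prefix ρ i) (ρ i) (ρ (suc i)) (𝔙-move i)
          (λ _ → trans (proj₂ (moves i)) (cong (E₂ (ρ i) ∘ proj₁ ∘ moves) (sym (clock i))))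

  coalition⇒verifier : Coalition2Wins → VerifierWins
  coalition⇒verifier (σ₂ , wins) = σ , λ ρ compatible →
    let σ₁ , outcome = lift ρ compatible in wins σ₁ (toVm ∘ ρ) outcome
    where open FromCoalition σ₂

  verifier⇒coalition : VerifierWins → Coalition2Wins
  verifier⇒coalition (σ , wins) = σ₂ , λ σ₁ ρ outcome → wins (toV₂ ∘ ρ) (project σ₁ ρ outcome)
    where open FromVerifier σ

lemma3 : ∀ {nAP : ℕ} (K : Kripke nAP) (A : DPA nAP) (ψ : LTL (APψ nAP))
         → Recognizes A ψ
         → Games.Coalition2Wins K A ⇔ Games.VerifierWins K A
lemma3 K A _ _ = mk⇔ coalition⇒verifier verifier⇒coalition
  where open Simulation K A
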